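{- Let $k$ be a positive integer and let $S=\{r_1 \pmod{m_1},\dots,r_k \pmod{m_k}\}$ be a system of congruences. Define $$\delta(S)=\{1 \pmod 2,\ 2r_1 \pmod{2m_1},\dots,2r_k \pmod{2m_k}\}.$$ Then $\delta(S)\in\mathcal{C}_{k+1}$ if and only if $S\in\mathcal{C}_k$.
   Context: For $a,m\in\mathbb{Z}$ with $m\geq 2$, the congruence class $a \pmod m$ is the set of integers congruent to $a$ modulo $m$. A system of congruences is a finite collection $\{r_1 \pmod{m_1},\dots,r_k \pmod{m_k}\}$ of congruence classes (each $m_i\geq 2$). It is a covering system if every integer lies in at least one of the classes; it is distinct if the moduli are pairwise distinct; it is minimal if removing any one of the classes yields a system that is no longer a covering system. For $k\in\mathbb{N}$, $\mathcal{C}_k$ denotes the collection of all distinct minimal covering systems with exactly $k$ moduli. -}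

module Defs where

open import Data.Nat using (ℕ; suc; _≤_)
open import Data.Integer as ℤ using (ℤ; +_; _-_)
open import Data.Integer.Divisibility using (_∣_)
open import Data.Product using (_×_; _,_; proj₁; proj₂)
open import Data.List using (List; _∷_; map; length; removeAt)
open import Data.List.Relation.Unary.All using (All)
open import Data.List.Relation.Unary.Any using (Any)
open import Data.List.Relation.Unary.Unique.Propositional using (Unique)
open import Relation.Binary.PropositionalEquality using (_≡_)
open import Relation.Nullary using (¬_)

Congruence : Set
Congruence = ℤ × ℕ

_∈ᶜ_ : ℤ → Congruence → Set
n ∈ᶜ (r , m) = (+ m) ∣ (n - r)

System : Set
System = List Congruence

IsSystem : System → Set
IsSystem S = All (λ c → 2 ≤ proj₂ c) S

moduli : System → List ℕ
moduli S = map proj₂ S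

IsCovering : System → Set
IsCovering S = (n : ℤ) → Any (n ∈ᶜ_) S

IsDistinct : System → Set
IsDistinct S = Unique (moduli S)

IsMinimal : System → Set
IsMinimal S = (i : _) → ¬ IsCovering (removeAt S i)

record InC (k : ℕ) (S : System) : Set where
  field
    system   : IsSystem S
    count    : length (moduli S) ≡ k
    distinct : IsDistinct S
    covering : IsCovering S
    minimal  : IsMinimal S

δ : System → System
δ S = (+ 1 , 2) ∷ map (λ c → ((+ 2) ℤ.* proj₁ c , 2 Data.Nat.* proj₂ c)) S

-- Halving is a bijection between the even integers and ℤ, under which 2r (mod 2m) corresponds
-- to r (mod m); the odd integers are exactly the class 1 (mod 2), which meets no class of
-- even modulus 2m with even residue 2r. Hence δ(S) covers ℤ iff S does, the class 1 (mod 2)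
-- can never be dropped from δ(S), and removing 2rᵢ (mod 2mᵢ) from δ(S) is δ of removing rᵢ (mod mᵢ)
-- from S. Distinctness transfers because m ↦ 2m is injective and 2 < 2mᵢ.
module Submission where

open import Defs
open import Data.Nat using (ℕ; suc; _≥_)
open import Data.List using (length)
open import Relation.Binary.PropositionalEquality using (_≡_)
open import Function.Bundles using (_⇔_)

import Data.Nat as ℕ
import Data.Nat.Properties as ℕ
import Data.Nat.Divisibility as ℕ
open import Data.Integer using (ℤ; +_; _+_; _-_; _*_; ∣_∣)
import Data.Integer.Properties as ℤ
open import Data.Integer.Divisibility using (_∣_)
import Data.Integer.Divisibility.Signed as Signed
open import Data.Integer.DivMod using (_/ℕ_; _%ℕ_; a≡a%ℕn+[a/ℕn]*n; n%ℕd<d)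
open import Data.Integer.Tactic.RingSolver using (solve-∀)
open import Data.Product using (_,_; proj₂)
open import Data.Empty using (⊥-elim)
open import Data.Fin using (Fin; zero; suc; cast)
open import Data.Fin.Properties using (cast-involutive)
open import Data.List using (_∷_; map; removeAt)
open import Data.List.Properties using (length-map; map-∘; map-removeAt)
import Data.List.Relation.Unary.All as All
import Data.List.Relation.Unary.All.Properties as All
open import Data.List.Relation.Unary.Any using (here; there)
import Data.List.Relation.Unary.Any as Any
import Data.List.Relation.Unary.Any.Properties as Any
open import Data.List.Relation.Unary.AllPairs using (_∷_)
open import Data.List.Relation.Unary.Unique.Propositional using (Unique)
import Data.List.Relation.Unary.Unique.Propositional.Properties as Unique
open import Relation.Binary.PropositionalEquality
  using (_≢_; sym; trans; cong; subst; module ≡-Reasoning)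
open import Relation.Nullary using (¬_)
open import Function.Base using (_∘_)
open import Function.Bundles using (mk⇔; Equivalence)

private
  variable
    S : System

dilate : Congruence → Congruence
dilate (r , m) = (+ 2 * r , 2 ℕ.* m)

data Parity : ℤ → Set where
  even : ∀ t → Parity (+ 2 * t)
  odd  : ∀ t → Parity (+ 1 + + 2 * t)

parity : ∀ n → Parity n
parity n with n %ℕ 2 | n%ℕd<d n 2 | a≡a%ℕn+[a/ℕn]*n n 2
... | 0           | _                 | n≡ = subst Parity
  (sym (trans n≡ (trans (ℤ.+-identityˡ _) (ℤ.*-comm (n /ℕ 2) (+ 2))))) (even (n /ℕ 2))
... | 1           | _                 | n≡ = subst Parity
  (sym (trans n≡ (cong (_+_ (+ 1)) (ℤ.*-comm (n /ℕ 2) (+ 2))))) (odd (n /ℕ 2))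
... | suc (suc _) | ℕ.s≤s (ℕ.s≤s ()) | _

2∤1+2*n : ∀ n → ¬ (+ 2 ∣ + 1 + + 2 * n)
2∤1+2*n n 2∣1+2n = ℕ.1+n≢n (ℕ.∣1⇒≡1 (Signed.∣⇒∣ᵤ 2∣1))
  where
  2∣1 : + 2 Signed.∣ + 1
  2∣1 = Signed.∣m+n∣n⇒∣m (Signed.∣ᵤ⇒∣ 2∣1+2n) (Signed.∣m⇒∣m*n n (Signed.∣-refl {+ 2}))

*-distribˡ-- : ∀ d t r → d * t - d * r ≡ d * (t - r)
*-distribˡ-- = solve-∀

∣d*t-d*r∣≡d*∣t-r∣ : ∀ d t r → ∣ + d * t - + d * r ∣ ≡ d ℕ.* ∣ t - r ∣
∣d*t-d*r∣≡d*∣t-r∣ d t r = begin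
  ∣ + d * t - + d * r ∣ ≡⟨ cong ∣_∣ (*-distribˡ-- (+ d) t r) ⟩
  ∣ + d * (t - r) ∣     ≡⟨ ℤ.abs-* (+ d) (t - r) ⟩
  d ℕ.* ∣ t - r ∣       ∎
  where open ≡-Reasoning

∈ᶜ-scale : ∀ d .{{_ : ℕ.NonZero d}} t r m → (+ d * t) ∈ᶜ (+ d * r , d ℕ.* m) ⇔ t ∈ᶜ (r , m)
∈ᶜ-scale d t r m = mk⇔
  (ℕ.*-cancelˡ-∣ d ∘ subst (d ℕ.* m ℕ.∣_) (∣d*t-d*r∣≡d*∣t-r∣ d t r))
  (subst (d ℕ.* m ℕ.∣_) (sym (∣d*t-d*r∣≡d*∣t-r∣ d t r)) ∘ ℕ.*-monoʳ-∣ d)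

2*-∈ᶜ-dilate : ∀ t c → (+ 2 * t) ∈ᶜ dilate c ⇔ t ∈ᶜ c
2*-∈ᶜ-dilate t (r , m) = ∈ᶜ-scale 2 t r m

odd∉dilate : ∀ t c → ¬ (+ 1 + + 2 * t) ∈ᶜ dilate c
odd∉dilate t (r , m) 2m∣odd =
  2∤1+2*n (t - r) (ℕ.∣-trans (ℕ.m∣m*n m) (subst (_∣_ (+ (2 ℕ.* m))) (odd-2r≡ t r) 2m∣odd))
  where
  odd-2r≡ : ∀ t r → + 1 + + 2 * t - + 2 * r ≡ + 1 + + 2 * (t - r)
  odd-2r≡ = solve-∀

even∉1[2] : ∀ t → ¬ (+ 2 * t) ∈ᶜ (+ 1 , 2)
even∉1[2] t = 2∤1+2*n (t - + 1) ∘ subst (_∣_ (+ 2)) (even-1≡ t)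
  where
  even-1≡ : ∀ t → + 2 * t - + 1 ≡ + 1 + + 2 * (t - + 1)
  even-1≡ = solve-∀

odd∈1[2] : ∀ t → (+ 1 + + 2 * t) ∈ᶜ (+ 1 , 2)
odd∈1[2] t = subst (_∣_ (+ 2)) (odd-1≡ t) (Signed.∣⇒∣ᵤ (Signed.∣m⇒∣m*n t (Signed.∣-refl {+ 2})))
  where
  odd-1≡ : ∀ t → + 2 * t ≡ + 1 + + 2 * t - + 1
  odd-1≡ = solve-∀

δ-covering : IsCovering (δ S) ⇔ IsCovering S
δ-covering {S} = mk⇔ to from
  where
  to : IsCovering (δ S) → IsCovering S
  to cov t with cov (+ 2 * t)
  ... | here  p = ⊥-elim (even∉1[2] t p)
  ... | there p = Any.map (λ {c} → Equivalence.to (2*-∈ᶜ-dilate t c)) (Any.map⁻ p)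

  from : IsCovering S → IsCovering (δ S)
  from cov n with parity n
  ... | even t = there (Any.map⁺ (Any.map (λ {c} → Equivalence.from (2*-∈ᶜ-dilate t c)) (cov t)))
  ... | odd  t = here (odd∈1[2] t)

map-dilate-not-covering : ¬ IsCovering (map dilate S)
map-dilate-not-covering {S} cov with Any.satisfied (Any.map⁻ {f = dilate} (cov (+ 1)))
... | c , 1∈c = odd∉dilate (+ 0) c 1∈c

removeAt-map : ∀ {a b} {A : Set a} {B : Set b} (f : A → B) xs i →
               removeAt (map f xs) i ≡ map f (removeAt xs (cast (length-map f xs) i))
removeAt-map f xs i = begin
  removeAt (map f xs) i          ≡⟨ cong (removeAt (map f xs)) (sym (cast-involutive (sym eq) eq i)) ⟩
  removeAt (map f xs) (cast _ j) ≡⟨ sym (map-removeAt xs j f) ⟩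
  map f (removeAt xs j)          ∎
  where
  open ≡-Reasoning
  eq : length (map f xs) ≡ length xs
  eq = length-map f xs
  j : Fin (length xs)
  j = cast eq i

δ-minimal : IsMinimal (δ S) ⇔ IsMinimal S
δ-minimal {S} = mk⇔ to from
  where
  to : IsMinimal (δ S) → IsMinimal S
  to min j cov = min (suc (cast (sym (length-map dilate S)) j))
    (subst (IsCovering ∘ ((+ 1 , 2) ∷_)) (map-removeAt S j dilate) (Equivalence.from δ-covering cov))

  from : IsMinimal S → IsMinimal (δ S)
  from min zero    = map-dilate-not-covering
  from min (suc i) cov = min (cast (length-map dilate S) i)
    (Equivalence.to δ-covering (subst (IsCovering ∘ ((+ 1 , 2) ∷_)) (removeAt-map dilate S i) cov))

m≢m*n : ∀ m .{{_ : ℕ.NonZero m}} {n} → 2 ℕ.≤ n → m ≢ m ℕ.* n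
m≢m*n m {n} 1<n m≡m*n = ℕ.<⇒≢ 1<n (ℕ.*-cancelˡ-≡ 1 n m (trans (ℕ.*-identityʳ m) m≡m*n))

moduli-map-dilate : moduli (map dilate S) ≡ map (2 ℕ.*_) (moduli S)
moduli-map-dilate {S} = trans (sym (map-∘ S)) (map-∘ S)

δ-distinct : IsSystem S → IsDistinct (δ S) ⇔ IsDistinct S
δ-distinct {S} sys = mk⇔ to from
  where
  to : IsDistinct (δ S) → IsDistinct S
  to (_ ∷ distinct) = Unique.map⁻ (subst Unique moduli-map-dilate distinct)

  from : IsDistinct S → IsDistinct (δ S)
  from distinct = All.map⁺ (All.map⁺ (All.map (m≢m*n 2) sys))
                ∷ subst Unique (sym moduli-map-dilate) (Unique.map⁺ (ℕ.*-cancelˡ-≡ _ _ 2) distinct)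

length-moduli-δ : length (moduli (δ S)) ≡ suc (length S)
length-moduli-δ {S} = cong suc (trans (length-map proj₂ (map dilate S)) (length-map dilate S))

δ-system : IsSystem S → IsSystem (δ S)
δ-system sys = ℕ.≤-refl All.∷ All.map⁺ (All.map (λ 2≤m → ℕ.≤-trans 2≤m (ℕ.m≤n*m _ 2)) sys)

proposition2p9 : (k : ℕ) → k ≥ 1 → (S : System) → IsSystem S → length S ≡ k →
                   (InC (suc k) (δ S) ⇔ InC k S)
proposition2p9 k _ S sys len = mk⇔ to from
  where

  to : InC (suc k) (δ S) → InC k S
  to C = record
    { system   = sys
    ; count    = trans (length-map proj₂ S) len
    ; distinct = Equivalence.to (δ-distinct sys) distinct
    ; covering = Equivalence.to δ-covering covering
    ; minimal  = Equivalence.to δ-minimal minimal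
    }
    where open InC C

  from : InC k S → InC (suc k) (δ S)
  from C = record
    { system   = δ-system sys
    ; count    = trans (length-moduli-δ {S}) (cong suc len)
    ; distinct = Equivalence.from (δ-distinct sys) distinct
    ; covering = Equivalence.from δ-covering covering
    ; minimal  = Equivalence.from δ-minimal minimal
    }
    where open InC C
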